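{- Let $t$ be a positive integer and let $C$ be a perfect $t$-deletion code of length $n$. For any positive integers $a,b,c$ with $c\le a<b\le n$, $$\sum_{a\le r\le b+2t}\# C_r\ge\frac{\binom{c+t-1}{t}}{\binom{c+b-a+3t-1}{t}}\cdot\frac{2}{\binom{n-1}{t}}\sum_{a\le p\le b}\binom{n-1}{p+t-1},$$ where $\binom{n-1}{m}=0$ for $m>n-1$.
   Context: $\mathbb{B}=\{0,1\}$, $\mathbb{B}^m$ is the set of binary sequences of length $m$. For a binary sequence $\mathbf{x}$, $\|\mathbf{x}\|$ is its number of runs. For a set $X$ of sequences and a positive integer $r$, $X_r=\{\mathbf{x}\in X:\|\mathbf{x}\|=r\}$. $\mathrm{dS}^t(\mathbf{x})$ is the set of sequences obtained from $\mathbf{x}$ by deleting exactly $t$ symbols, and $\mathrm{dS}^t(X)=\bigcup_{\mathbf{x}\in X}\mathrm{dS}^t(\mathbf{x})$. A set $C\subseteq\mathbb{B}^n$ is a $t$-deletion code of length $n$ if $\mathrm{dS}^t(\mathbf{c})\cap\mathrm{dS}^t(\mathbf{d})=\emptyset$ for all distinct $\mathbf{c},\mathbf{d}\in C$; for $n\ge t$ it is perfect if additionally $\mathrm{dS}^t(C)=\mathbb{B}^{n-t}$. $\#X$ is the cardinality of $X$. -}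

module Defs where

open import Data.Bool using (Bool; true; false; _∧_; if_then_else_)
open import Data.Nat using (ℕ; zero; suc; _+_; _*_; _∸_; _≤_; _≤ᵇ_)
open import Data.Nat.Properties using (_≟_)
open import Data.List using (List; []; _∷_; length; map; upTo; filter; _++_)
open import Data.Nat.ListAction using (sum)
open import Data.List.Relation.Binary.Sublist.Propositional using (_⊆_)
open import Data.Vec using (Vec; []; _∷_; toList)
open import Data.Product using (_×_; ∃-syntax)
open import Relation.Binary.PropositionalEquality using (_≡_; _≢_)
open import Relation.Nullary using (¬_)
open import Relation.Nullary.Decidable using (⌊_⌋)

runsFrom : Bool → List Bool → ℕ
runsFrom b [] = 0
runsFrom b (x ∷ xs) = if ⌊ Data.Bool._≟_ b x ⌋ then runsFrom x xs else suc (runsFrom x xs)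

runs : List Bool → ℕ
runs [] = 0
runs (x ∷ xs) = suc (runsFrom x xs)

‖_‖ : ∀ {m} → Vec Bool m → ℕ
‖ x ‖ = runs (toList x)

dS : ℕ → List Bool → List Bool → Set
dS t x y = (y ⊆ x) × (length y + t ≡ length x)

-- A subset C ⊆ B^n is given by its (Boolean) characteristic function.
Code : ℕ → Set
Code n = Vec Bool n → Bool

IsDeletionCode : (t n : ℕ) → Code n → Set
IsDeletionCode t n C =
  ∀ (c d : Vec Bool n) → C c ≡ true → C d ≡ true → c ≢ d →
  ∀ (y : List Bool) → ¬ (dS t (toList c) y × dS t (toList d) y)

IsPerfectDeletionCode : (t n : ℕ) → Code n → Set
IsPerfectDeletionCode t n C =
  t ≤ n × IsDeletionCode t n C ×
  (∀ (y : Vec Bool (n ∸ t)) → ∃[ c ] (C c ≡ true × dS t (toList c) (toList y)))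

allSeqs : (m : ℕ) → List (Vec Bool m)
allSeqs zero = [] ∷ []
allSeqs (suc m) = map (false ∷_) (allSeqs m) ++ map (true ∷_) (allSeqs m)

countRuns : ∀ {n} → Code n → ℕ → ℕ
countRuns {n} C r = length (filter (λ x → (C x ∧ ⌊ ‖ x ‖ ≟ r ⌋) Data.Bool.≟ true) (allSeqs n))

sumRange : ℕ → ℕ → (ℕ → ℕ) → ℕ
sumRange lo hi f = sum (map (λ i → f (lo + i)) (upTo (suc hi ∸ lo)))

module Submission where

-- Put N = n - t.  Every y ∈ 𝔹^N is a t-deletion of some codeword x (this covering half of
-- perfection is all that is used), and deleting t symbols never increases the number of runs
-- and lowers it by at most 2t.  Hence the words y with a ≤ ‖y‖ ≤ b lie in deletion balls of
-- codewords x with a ≤ ‖x‖ ≤ b + 2t, and such a ball has at most C(‖x‖+t-1, t) ≤ C(b+3t-1, t)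
-- elements (a deletion pattern is a multiset of t runs).  This gives covering-count:
--     Σ_{a≤p≤b} #{y ∈ 𝔹^N : ‖y‖ = p}  ≤  (Σ_{a≤r≤b+2t} #C_r) · C(b+3t-1, t).
-- Each summand on the left is 2 C(N-1, p-1); the subset identity
-- C(n-1, p+t-1) C(p+t-1, t) = C(n-1, t) C(N-1, p-1) and log-concavity of x ↦ C(x+t, t) turn it
-- into the corresponding summand of the theorem times C(b+3t-1, t) (length-bound).  Cancelling
-- this common factor proves the theorem.

open import Defs
open import Data.Nat using (ℕ; _+_; _*_; _∸_; _≤_; _<_)
open import Data.Nat.Combinatorics using (_C_)

open import Data.Bool using (Bool; true; false; _∧_; T)
import Data.Bool as Bool
open import Data.Bool.Properties using (∧-conicalʳ)
open import Data.Empty using (⊥-elim)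
open import Data.List using (List; []; _∷_; length; map; _++_; filter; replicate; applyUpTo; concatMap)
open import Data.List.Properties
  using (length-++; length-map; length-replicate; map-applyUpTo; filter-++; filter-none; filter-≐)
open import Data.List.Membership.Propositional using (_∈_)
open import Data.List.Membership.Propositional.Properties
  using (∈-map⁺; ∈-map⁻; ∈-++⁺ˡ; ∈-++⁺ʳ; ∈-++⁻; ∈-∃++; ∈-concatMap⁺; ∈-filter⁺; ∈-filter⁻)
open import Data.List.Relation.Binary.Sublist.Propositional using (_⊆_; []; _∷_; _∷ʳ_)
open import Data.List.Relation.Binary.Sublist.Propositional.Properties using (length-mono-≤)
open import Data.List.Relation.Unary.All using ([]; universal; lookup)
open import Data.List.Relation.Unary.Any using (Any; here; there)
import Data.List.Relation.Unary.Any as Any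
open import Data.List.Relation.Unary.Unique.Propositional using (Unique; []; _∷_)
import Data.List.Relation.Unary.Unique.Propositional.Properties as Unique
open import Data.Nat
open import Data.Nat.Properties
open import Data.Nat.Combinatorics
  using (nCk+nC[k+1]≡[n+1]C[k+1]; k>n⇒nCk≡0; nCn≡1; nCk≡n!/k![n-k]!; k![n∸k]!∣n!)
open import Data.Nat.DivMod using (m/n*n≡m)
open import Data.Nat.ListAction using (sum)
open import Data.Nat.Solver using (module +-*-Solver)
open import Data.Product using (_,_; _×_; ∃-syntax; proj₁; proj₂)
open import Data.Sum using (inj₁; inj₂)
open import Data.Unit using (tt)
open import Data.Vec using (Vec; []; _∷_; toList)
open import Data.Vec.Properties using (toList-injective; ∷-injectiveʳ)
open import Data.Vec.Relation.Binary.Equality.Cast using (cast-is-id)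
open import Relation.Binary.PropositionalEquality
open import Relation.Nullary using (¬_; Dec; yes; no; does)
open import Relation.Nullary.Decidable using (⌊_⌋; toWitness)
open import Relation.Unary using (Decidable)
open +-*-Solver

mono-from-step : (f : ℕ → ℕ) → (∀ n → f n ≤ f (suc n)) → ∀ {m n} → m ≤ n → f m ≤ f n
mono-from-step f step m≤n = go (≤⇒≤′ m≤n)
  where
  go : ∀ {m n} → m ≤′ n → f m ≤ f n
  go ≤′-refl = ≤-refl
  go (≤′-step m≤′n) = ≤-trans (go m≤′n) (step _)

C-mono-upper : ∀ k {m n} → m ≤ n → (m C k) ≤ (n C k)
C-mono-upper k = mono-from-step (_C k) (step k)
  where
  step : ∀ k n → (n C k) ≤ (suc n C k)
  step zero n = ≤-refl
  step (suc k) n = ≤-trans (m≤n+m (n C suc k) (n C k)) (≤-reflexive (nCk+nC[k+1]≡[n+1]C[k+1] n k))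

C-factorial : ∀ {n k} → k ≤ n → (n C k) * (k ! * (n ∸ k) !) ≡ n !
C-factorial {n} {k} k≤n = trans (cong (_* (k ! * (n ∸ k) !)) (nCk≡n!/k![n-k]! k≤n)) (m/n*n≡m (k![n∸k]!∣n! k≤n))
  where instance _ = k !* (n ∸ k) !≢0

-- Both products in the subset identity below count the ways to split an m-set into blocks
-- of sizes t, p and m - (p + t); multiplied by the block factorials they give m!.
C-nested-factorial : ∀ {m} p t → p + t ≤ m →
  (m C (p + t)) * ((p + t) C t) * (t ! * (p ! * (m ∸ (p + t)) !)) ≡ m !
C-nested-factorial {m} p t p+t≤m = begin
  (m C (p + t)) * ((p + t) C t) * (t ! * (p ! * r !))
    ≡⟨ solve 5 (λ X Y T P R → X :* Y :* (T :* (P :* R)) := X :* (Y :* (T :* P) :* R)) refl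
         (m C (p + t)) ((p + t) C t) (t !) (p !) (r !) ⟩
  (m C (p + t)) * (((p + t) C t) * (t ! * p !) * r !)
    ≡⟨ cong (λ q → (m C (p + t)) * (((p + t) C t) * (t ! * q !) * r !)) (m+n∸n≡m p t) ⟨
  (m C (p + t)) * (((p + t) C t) * (t ! * (p + t ∸ t) !) * r !)
    ≡⟨ cong (λ z → (m C (p + t)) * (z * r !)) (C-factorial (m≤n+m t p)) ⟩
  (m C (p + t)) * ((p + t) ! * r !)
    ≡⟨ C-factorial p+t≤m ⟩
  m ! ∎
  where
  open ≡-Reasoning
  r : ℕ
  r = m ∸ (p + t)

C-complement-factorial : ∀ {m} p t → p + t ≤ m →
  (m C t) * ((m ∸ t) C p) * (t ! * (p ! * (m ∸ (p + t)) !)) ≡ m !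
C-complement-factorial {m} p t p+t≤m = begin
  (m C t) * ((m ∸ t) C p) * (t ! * (p ! * r !))
    ≡⟨ solve 5 (λ X Y T P R → X :* Y :* (T :* (P :* R)) := X :* (T :* (Y :* (P :* R)))) refl
         (m C t) ((m ∸ t) C p) (t !) (p !) (r !) ⟩
  (m C t) * (t ! * (((m ∸ t) C p) * (p ! * r !)))
    ≡⟨ cong (λ q → (m C t) * (t ! * (((m ∸ t) C p) * (p ! * q !)))) m∸t∸p≡r ⟨
  (m C t) * (t ! * (((m ∸ t) C p) * (p ! * (m ∸ t ∸ p) !)))
    ≡⟨ cong (λ z → (m C t) * (t ! * z)) (C-factorial (m+n≤o⇒m≤o∸n p p+t≤m)) ⟩
  (m C t) * (t ! * (m ∸ t) !)
    ≡⟨ C-factorial (≤-trans (m≤n+m t p) p+t≤m) ⟩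
  m ! ∎
  where
  open ≡-Reasoning
  r : ℕ
  r = m ∸ (p + t)
  m∸t∸p≡r : m ∸ t ∸ p ≡ r
  m∸t∸p≡r = trans (∸-+-assoc m t p) (cong (m ∸_) (+-comm t p))

-- Choosing a (p+t)-subset of an m-set and then a t-subset of it is the same as choosing the
-- t-subset first and then p more elements: C(m,p+t) C(p+t,t) = C(m,t) C(m-t,p).
-- Both sides vanish when p + t > m.
C-subset-of-subset : ∀ m p t → (m C (p + t)) * ((p + t) C t) ≡ (m C t) * ((m ∸ t) C p)
C-subset-of-subset m p t with p + t ≤? m
... | yes p+t≤m = *-cancelʳ-≡ _ _ (t ! * (p ! * (m ∸ (p + t)) !)) {{t!p!r!≢0}}
                    (trans (C-nested-factorial p t p+t≤m) (sym (C-complement-factorial p t p+t≤m)))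
  where
  t!p!r!≢0 : NonZero (t ! * (p ! * (m ∸ (p + t)) !))
  t!p!r!≢0 = m*n≢0 (t !) (p ! * (m ∸ (p + t)) !) {{t !≢0}} {{p !* (m ∸ (p + t)) !≢0}}
... | no p+t≰m with t ≤? m
...   | yes t≤m = begin
  (m C (p + t)) * ((p + t) C t) ≡⟨ cong (_* ((p + t) C t)) (k>n⇒nCk≡0 (≰⇒> p+t≰m)) ⟩
  0                             ≡⟨ *-zeroʳ (m C t) ⟨
  (m C t) * 0                   ≡⟨ cong ((m C t) *_) (k>n⇒nCk≡0 m∸t<p) ⟨
  (m C t) * ((m ∸ t) C p) ∎
  where
  open ≡-Reasoning
  m∸t<p : m ∸ t < p
  m∸t<p = +-cancelʳ-< t (m ∸ t) p (subst (_< p + t) (sym (m∸n+n≡m t≤m)) (≰⇒> p+t≰m))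
...   | no t≰m = trans (cong (_* ((p + t) C t)) (k>n⇒nCk≡0 (≰⇒> p+t≰m)))
                       (sym (cong (_* ((m ∸ t) C p)) (k>n⇒nCk≡0 (≰⇒> t≰m))))

rising : ℕ → ℕ → ℕ
rising x zero = 1
rising x (suc t) = rising x t * (x + t)

rising-factorial : ∀ x t → (x + t) ! ≡ rising (suc x) t * x !
rising-factorial x zero = trans (cong _! (+-identityʳ x)) (sym (*-identityˡ (x !)))
rising-factorial x (suc t) = begin
  (x + suc t) !                      ≡⟨ cong _! (+-suc x t) ⟩
  suc (x + t) * (x + t) !            ≡⟨ cong (suc (x + t) *_) (rising-factorial x t) ⟩
  suc (x + t) * (rising (suc x) t * x !)
    ≡⟨ solve 3 (λ a r f → a :* (r :* f) := r :* a :* f) refl (suc (x + t)) (rising (suc x) t) (x !) ⟩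
  rising (suc x) t * (suc x + t) * x ! ∎
  where open ≡-Reasoning

C-rising : ∀ x t → ((x + t) C t) * t ! ≡ rising (suc x) t
C-rising x t = *-cancelʳ-≡ _ _ (x !) {{x !≢0}} (begin
  ((x + t) C t) * t ! * x !               ≡⟨ *-assoc ((x + t) C t) (t !) (x !) ⟩
  ((x + t) C t) * (t ! * x !)             ≡⟨ cong (λ y → ((x + t) C t) * (t ! * y !)) (m+n∸n≡m x t) ⟨
  ((x + t) C t) * (t ! * (x + t ∸ t) !)   ≡⟨ C-factorial (m≤n+m t x) ⟩
  (x + t) !                               ≡⟨ rising-factorial x t ⟩
  rising (suc x) t * x ! ∎)
  where open ≡-Reasoning

-- Rising factorials are log-concave in their base: each factor satisfies
-- (c+i)(c+d+e+i) ≤ (c+d+i)(c+e+i).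
rising-log-concave : ∀ c d e t → rising c t * rising (c + d + e) t ≤ rising (c + d) t * rising (c + e) t
rising-log-concave c d e zero = ≤-refl
rising-log-concave c d e (suc t) = begin
  rising c t * (c + t) * (rising (c + d + e) t * (c + d + e + t))
    ≡⟨ interchange (rising c t) (c + t) (rising (c + d + e) t) (c + d + e + t) ⟩
  (rising c t * rising (c + d + e) t) * ((c + t) * (c + d + e + t))
    ≤⟨ *-mono-≤ (rising-log-concave c d e t) factor ⟩
  (rising (c + d) t * rising (c + e) t) * ((c + d + t) * (c + e + t))
    ≡⟨ interchange (rising (c + d) t) (c + d + t) (rising (c + e) t) (c + e + t) ⟨
  rising (c + d) t * (c + d + t) * (rising (c + e) t * (c + e + t)) ∎
  where
  open ≤-Reasoning
  interchange : ∀ a x b y → a * x * (b * y) ≡ (a * b) * (x * y)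
  interchange = solve 4 (λ a x b y → a :* x :* (b :* y) := (a :* b) :* (x :* y)) refl
  factor : (c + t) * (c + d + e + t) ≤ (c + d + t) * (c + e + t)
  factor = ≤-trans (m≤m+n _ (d * e)) (≤-reflexive
    (solve 4 (λ c d e t → (c :+ t) :* (c :+ d :+ e :+ t) :+ d :* e := (c :+ d :+ t) :* (c :+ e :+ t)) refl c d e t))

C-log-concave : ∀ c d e t →
  ((c + t) C t) * ((c + d + e + t) C t) ≤ ((c + d + t) C t) * ((c + e + t) C t)
C-log-concave c d e t = *-cancelʳ-≤ _ _ (t ! * t !) {{t !* t !≢0}} (begin
  ((c + t) C t) * ((c + d + e + t) C t) * (t ! * t !)
    ≡⟨ spread ((c + t) C t) ((c + d + e + t) C t) ⟩
  (((c + t) C t) * t !) * (((c + d + e + t) C t) * t !)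
    ≡⟨ cong₂ _*_ (C-rising c t) (C-rising (c + d + e) t) ⟩
  rising (suc c) t * rising (suc (c + d + e)) t
    ≤⟨ rising-log-concave (suc c) d e t ⟩
  rising (suc (c + d)) t * rising (suc (c + e)) t
    ≡⟨ cong₂ _*_ (C-rising (c + d) t) (C-rising (c + e) t) ⟨
  (((c + d + t) C t) * t !) * (((c + e + t) C t) * t !)
    ≡⟨ spread ((c + d + t) C t) ((c + e + t) C t) ⟨
  ((c + d + t) C t) * ((c + e + t) C t) * (t ! * t !) ∎)
  where
  open ≤-Reasoning
  spread : ∀ x y → x * y * (t ! * t !) ≡ (x * t !) * (y * t !)
  spread x y = solve 3 (λ x y f → x :* y :* (f :* f) := (x :* f) :* (y :* f)) refl x y (t !)

-- multichoose r t: the number of size-t multisets drawn from r kinds, given by the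
-- Pascal-type recursion that the deletion-ball enumeration below follows.
multichoose : ℕ → ℕ → ℕ
multichoose zero zero = 1
multichoose zero (suc t) = 0
multichoose (suc r) zero = 1
multichoose (suc r) (suc t) = multichoose r (suc t) + multichoose (suc r) t

multichoose-C : ∀ r t → multichoose (suc r) t ≡ (r + t) C t
multichoose-C r zero = refl
multichoose-C zero (suc t) = trans (multichoose-C zero t) (trans (nCn≡1 t) (sym (nCn≡1 (suc t))))
multichoose-C (suc r) (suc t) = begin
  multichoose (suc r) (suc t) + multichoose (suc (suc r)) t
    ≡⟨ cong₂ _+_ (multichoose-C r (suc t)) (multichoose-C (suc r) t) ⟩
  ((r + suc t) C suc t) + ((suc r + t) C t)
    ≡⟨ cong (λ m → ((r + suc t) C suc t) + (m C t)) (sym (+-suc r t)) ⟩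
  ((r + suc t) C suc t) + ((r + suc t) C t)
    ≡⟨ +-comm ((r + suc t) C suc t) _ ⟩
  ((r + suc t) C t) + ((r + suc t) C suc t)
    ≡⟨ nCk+nC[k+1]≡[n+1]C[k+1] (r + suc t) t ⟩
  (suc r + suc t) C suc t ∎
  where open ≡-Reasoning

multichoose-mono : ∀ t {r s} → r ≤ s → multichoose r t ≤ multichoose s t
multichoose-mono t = mono-from-step (λ r → multichoose r t) (λ r → step r t)
  where
  step : ∀ r t → multichoose r t ≤ multichoose (suc r) t
  step zero zero = ≤-refl
  step zero (suc t) = z≤n
  step (suc r) zero = ≤-refl
  step (suc r) (suc t) = m≤m+n (multichoose (suc r) (suc t)) (multichoose (suc (suc r)) t)

multichoose-pos : ∀ {r} t → 1 ≤ r → 1 ≤ multichoose r t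
multichoose-pos {suc r} zero _ = ≤-refl
multichoose-pos {suc r} (suc t) 1≤r =
  ≤-trans (multichoose-pos t 1≤r) (m≤n+m (multichoose (suc r) t) (multichoose r (suc t)))

-- switch b y is 1 when y starts a new run after b, and 0 otherwise.
switch : Bool → Bool → ℕ
switch false false = 0
switch false true = 1
switch true false = 1
switch true true = 0

runsFrom-∷ : ∀ b y zs → runsFrom b (y ∷ zs) ≡ switch b y + runsFrom y zs
runsFrom-∷ false false zs = refl
runsFrom-∷ false true zs = refl
runsFrom-∷ true false zs = refl
runsFrom-∷ true true zs = refl

switch≤1 : ∀ b y → switch b y ≤ 1
switch≤1 false false = z≤n
switch≤1 false true = ≤-refl
switch≤1 true false = ≤-refl
switch≤1 true true = z≤n

switch-triangle : ∀ b y z → switch b z ≤ switch b y + switch y z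
switch-triangle false false z = ≤-refl
switch-triangle false true false = z≤n
switch-triangle false true true = s≤s z≤n
switch-triangle true false false = s≤s z≤n
switch-triangle true false true = z≤n
switch-triangle true true z = ≤-refl

runsFrom-rebase : ∀ b y zs → runsFrom b zs ≤ switch b y + runsFrom y zs
runsFrom-rebase b y [] = z≤n
runsFrom-rebase b y (z ∷ zs) = begin
  runsFrom b (z ∷ zs)                  ≡⟨ runsFrom-∷ b z zs ⟩
  switch b z + runsFrom z zs           ≤⟨ +-monoˡ-≤ _ (switch-triangle b y z) ⟩
  switch b y + switch y z + runsFrom z zs ≡⟨ +-assoc (switch b y) _ _ ⟩
  switch b y + (switch y z + runsFrom z zs) ≡⟨ cong (switch b y +_) (runsFrom-∷ y z zs) ⟨
  switch b y + runsFrom y (z ∷ zs) ∎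
  where open ≤-Reasoning

runsFrom-⊆ : ∀ b {xs ys : List Bool} → xs ⊆ ys → runsFrom b xs ≤ runsFrom b ys
runsFrom-⊆ b [] = z≤n
runsFrom-⊆ b {xs} {y ∷ ys} (y ∷ʳ xs⊆ys) = begin
  runsFrom b xs               ≤⟨ runsFrom-⊆ b xs⊆ys ⟩
  runsFrom b ys               ≤⟨ runsFrom-rebase b y ys ⟩
  switch b y + runsFrom y ys  ≡⟨ runsFrom-∷ b y ys ⟨
  runsFrom b (y ∷ ys) ∎
  where open ≤-Reasoning
runsFrom-⊆ b {x ∷ xs} {.x ∷ ys} (refl ∷ xs⊆ys) = begin
  runsFrom b (x ∷ xs)         ≡⟨ runsFrom-∷ b x xs ⟩
  switch b x + runsFrom x xs  ≤⟨ +-monoʳ-≤ (switch b x) (runsFrom-⊆ x xs⊆ys) ⟩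
  switch b x + runsFrom x ys  ≡⟨ runsFrom-∷ b x ys ⟨
  runsFrom b (x ∷ ys) ∎
  where open ≤-Reasoning

two-more-runs : ∀ R D → 2 + (R + 2 * D) ≡ R + 2 * suc D
two-more-runs = solve 2 (λ R D → con 2 :+ (R :+ con 2 :* D) := R :+ con 2 :* (con 1 :+ D)) refl

runsFrom-⊇ : ∀ b {xs ys : List Bool} → xs ⊆ ys →
  runsFrom b ys ≤ runsFrom b xs + 2 * (length ys ∸ length xs)
runsFrom-⊇ b [] = z≤n
runsFrom-⊇ b {xs} {y ∷ ys} (y ∷ʳ xs⊆ys) = begin
  runsFrom b (y ∷ ys)               ≡⟨ runsFrom-∷ b y ys ⟩
  switch b y + runsFrom y ys        ≤⟨ +-mono-≤ (switch≤1 b y) (runsFrom-rebase y b ys) ⟩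
  1 + (switch y b + runsFrom b ys)  ≤⟨ +-monoʳ-≤ 1 (+-mono-≤ (switch≤1 y b) (runsFrom-⊇ b xs⊆ys)) ⟩
  2 + (R + 2 * D)                   ≡⟨ two-more-runs R D ⟩
  R + 2 * suc D                     ≡⟨ cong (λ k → R + 2 * k) (+-∸-assoc 1 (length-mono-≤ xs⊆ys)) ⟨
  R + 2 * (length (y ∷ ys) ∸ length xs) ∎
  where
  open ≤-Reasoning
  R D : ℕ
  R = runsFrom b xs
  D = length ys ∸ length xs
runsFrom-⊇ b {x ∷ xs} {.x ∷ ys} (refl ∷ xs⊆ys) = begin
  runsFrom b (x ∷ ys)               ≡⟨ runsFrom-∷ b x ys ⟩
  switch b x + runsFrom x ys        ≤⟨ +-monoʳ-≤ (switch b x) (runsFrom-⊇ x xs⊆ys) ⟩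
  switch b x + (runsFrom x xs + 2 * D) ≡⟨ +-assoc (switch b x) _ _ ⟨
  switch b x + runsFrom x xs + 2 * D ≡⟨ cong (_+ 2 * D) (runsFrom-∷ b x xs) ⟨
  runsFrom b (x ∷ xs) + 2 * D ∎
  where
  open ≤-Reasoning
  D : ℕ
  D = length ys ∸ length xs

runsFrom≤length : ∀ b xs → runsFrom b xs ≤ length xs
runsFrom≤length b [] = z≤n
runsFrom≤length b (y ∷ ys) =
  ≤-trans (≤-reflexive (runsFrom-∷ b y ys)) (+-mono-≤ (switch≤1 b y) (runsFrom≤length y ys))

-- The statements above for runs = 1 + (switches relative to the first symbol).
runs-⊆ : ∀ {xs ys : List Bool} → xs ⊆ ys → runs xs ≤ runs ys
runs-⊆ {[]} _ = z≤n
runs-⊆ {x ∷ xs} {y ∷ ys} (y ∷ʳ xs⊆ys) = ≤-trans (runs-⊆ xs⊆ys) (drop-head y ys)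
  where
  drop-head : ∀ y ys → runs ys ≤ runs (y ∷ ys)
  drop-head y [] = z≤n
  drop-head y (z ∷ zs) = s≤s (≤-trans (m≤n+m _ (switch y z)) (≤-reflexive (sym (runsFrom-∷ y z zs))))
runs-⊆ {x ∷ xs} {.x ∷ ys} (refl ∷ xs⊆ys) = s≤s (runsFrom-⊆ x xs⊆ys)

runs-⊇ : ∀ {xs ys : List Bool} → xs ⊆ ys → runs ys ≤ runs xs + 2 * (length ys ∸ length xs)
runs-⊇ {[]} {ys} _ = ≤-trans (runs≤length ys) (m≤n*m (length ys) 2)
  where
  runs≤length : ∀ xs → runs xs ≤ length xs
  runs≤length [] = z≤n
  runs≤length (x ∷ xs) = s≤s (runsFrom≤length x xs)
runs-⊇ {x ∷ xs} {y ∷ ys} (y ∷ʳ xs⊆ys) = begin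
  runs (y ∷ ys)           ≤⟨ add-head y ys ⟩
  suc (runs ys)           ≤⟨ s≤s (runs-⊇ xs⊆ys) ⟩
  suc (R + 2 * D)         ≤⟨ n≤1+n _ ⟩
  2 + (R + 2 * D)         ≡⟨ two-more-runs R D ⟩
  R + 2 * suc D           ≡⟨ cong (λ k → R + 2 * k) (+-∸-assoc 1 (length-mono-≤ xs⊆ys)) ⟨
  R + 2 * (length (y ∷ ys) ∸ length (x ∷ xs)) ∎
  where
  open ≤-Reasoning
  R D : ℕ
  R = runs (x ∷ xs)
  D = length ys ∸ length (x ∷ xs)
  add-head : ∀ y ys → runs (y ∷ ys) ≤ suc (runs ys)
  add-head y [] = ≤-refl
  add-head y (z ∷ zs) = s≤s (≤-trans (≤-reflexive (runsFrom-∷ y z zs)) (+-monoˡ-≤ _ (switch≤1 y z)))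
runs-⊇ {x ∷ xs} {.x ∷ ys} (refl ∷ xs⊆ys) = s≤s (runsFrom-⊇ x xs⊆ys)

deletion-runs : ∀ t x y → dS t x y → runs y ≤ runs x × runs x ≤ runs y + 2 * t
deletion-runs t x y (y⊆x , |y|+t≡|x|) =
  runs-⊆ y⊆x , ≤-trans (runs-⊇ y⊆x) (≤-reflexive (cong (λ k → runs y + 2 * k) deleted))
  where
  deleted : length x ∸ length y ≡ t
  deleted = trans (cong (_∸ length y) (sym |y|+t≡|x|)) (m+n∸m≡n (length y) t)

allSeqs-complete : ∀ {m} (v : Vec Bool m) → v ∈ allSeqs m
allSeqs-complete [] = here refl
allSeqs-complete {suc m} (false ∷ v) = ∈-++⁺ˡ (∈-map⁺ (false ∷_) (allSeqs-complete v))
allSeqs-complete {suc m} (true ∷ v) = ∈-++⁺ʳ (map (false ∷_) (allSeqs m)) (∈-map⁺ (true ∷_) (allSeqs-complete v))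

allSeqs-unique : ∀ m → Unique (allSeqs m)
allSeqs-unique zero = [] ∷ []
allSeqs-unique (suc m) = Unique.++⁺ (Unique.map⁺ ∷-injectiveʳ (allSeqs-unique m))
                                    (Unique.map⁺ ∷-injectiveʳ (allSeqs-unique m)) heads-differ
  where
  heads-differ : ∀ {v} → ¬ (v ∈ map (false ∷_) (allSeqs m) × v ∈ map (true ∷_) (allSeqs m))
  heads-differ (v∈₀ , v∈₁) with ∈-map⁻ (false ∷_) v∈₀ | ∈-map⁻ (true ∷_) v∈₁
  ... | _ , _ , refl | _ , _ , ()

length-filter-map : ∀ {A B : Set} {P : B → Set} (P? : Decidable P) (g : A → B) (xs : List A) →
  length (filter P? (map g xs)) ≡ length (filter (λ x → P? (g x)) xs)
length-filter-map P? g [] = refl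
length-filter-map P? g (x ∷ xs) with does (P? (g x))
... | true = cong suc (length-filter-map P? g xs)
... | false = length-filter-map P? g xs

countBy : ∀ m → (Vec Bool m → ℕ) → ℕ → ℕ
countBy m f q = length (filter (λ v → f v ≟ q) (allSeqs m))

countBy-suc : ∀ m (f : Vec Bool (suc m) → ℕ) q →
  countBy (suc m) f q ≡ countBy m (λ v → f (false ∷ v)) q + countBy m (λ v → f (true ∷ v)) q
countBy-suc m f q = begin
  length (filter P? (withFalse ++ withTrue))                 ≡⟨ cong length (filter-++ P? withFalse withTrue) ⟩
  length (filter P? withFalse ++ filter P? withTrue)         ≡⟨ length-++ (filter P? withFalse) ⟩
  length (filter P? withFalse) + length (filter P? withTrue) ≡⟨ cong₂ _+_ (length-filter-map P? (false ∷_) (allSeqs m))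
                                                          (length-filter-map P? (true ∷_) (allSeqs m)) ⟩
  countBy m (λ v → f (false ∷ v)) q + countBy m (λ v → f (true ∷ v)) q ∎
  where
  open ≡-Reasoning
  P? : ∀ v → Dec (f v ≡ q)
  P? v = f v ≟ q
  withFalse withTrue : List (Vec Bool (suc m))
  withFalse = map (false ∷_) (allSeqs m)
  withTrue = map (true ∷_) (allSeqs m)

countBy-suc-suc : ∀ m (f : Vec Bool m → ℕ) q → countBy m (λ v → suc (f v)) (suc q) ≡ countBy m f q
countBy-suc-suc m f q =
  cong length (filter-≐ (λ v → suc (f v) ≟ suc q) (λ v → f v ≟ q) (suc-injective , cong suc) (allSeqs m))

countBy-suc-zero : ∀ m (f : Vec Bool m → ℕ) → countBy m (λ v → suc (f v)) 0 ≡ 0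
countBy-suc-zero m f = cong length (filter-none (λ v → suc (f v) ≟ 0) (universal (λ _ ()) (allSeqs m)))

switches-count : ∀ m b q → countBy m (λ v → runsFrom b (toList v)) q ≡ m C q
switches-count zero b zero = refl
switches-count zero b (suc q) = refl
switches-count (suc m) false zero = begin
  countBy (suc m) (λ v → runsFrom false (toList v)) 0
    ≡⟨ countBy-suc m (λ v → runsFrom false (toList v)) 0 ⟩
  countBy m (λ v → runsFrom false (toList v)) 0 + countBy m (λ v → suc (runsFrom true (toList v))) 0
    ≡⟨ cong₂ _+_ (switches-count m false 0) (countBy-suc-zero m (λ v → runsFrom true (toList v))) ⟩
  1 + 0 ∎
  where open ≡-Reasoning
switches-count (suc m) true zero = begin
  countBy (suc m) (λ v → runsFrom true (toList v)) 0
    ≡⟨ countBy-suc m (λ v → runsFrom true (toList v)) 0 ⟩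
  countBy m (λ v → suc (runsFrom false (toList v))) 0 + countBy m (λ v → runsFrom true (toList v)) 0
    ≡⟨ cong₂ _+_ (countBy-suc-zero m (λ v → runsFrom false (toList v))) (switches-count m true 0) ⟩
  1 ∎
  where open ≡-Reasoning
switches-count (suc m) false (suc q) = begin
  countBy (suc m) (λ v → runsFrom false (toList v)) (suc q)
    ≡⟨ countBy-suc m (λ v → runsFrom false (toList v)) (suc q) ⟩
  countBy m (λ v → runsFrom false (toList v)) (suc q) + countBy m (λ v → suc (runsFrom true (toList v))) (suc q)
    ≡⟨ cong₂ _+_ (switches-count m false (suc q))
                 (trans (countBy-suc-suc m (λ v → runsFrom true (toList v)) q) (switches-count m true q)) ⟩
  (m C suc q) + (m C q)   ≡⟨ +-comm (m C suc q) (m C q) ⟩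
  (m C q) + (m C suc q)   ≡⟨ nCk+nC[k+1]≡[n+1]C[k+1] m q ⟩
  (suc m C suc q) ∎
  where open ≡-Reasoning
switches-count (suc m) true (suc q) = begin
  countBy (suc m) (λ v → runsFrom true (toList v)) (suc q)
    ≡⟨ countBy-suc m (λ v → runsFrom true (toList v)) (suc q) ⟩
  countBy m (λ v → suc (runsFrom false (toList v))) (suc q) + countBy m (λ v → runsFrom true (toList v)) (suc q)
    ≡⟨ cong₂ _+_ (trans (countBy-suc-suc m (λ v → runsFrom false (toList v)) q) (switches-count m false q))
                 (switches-count m true (suc q)) ⟩
  (m C q) + (m C suc q)   ≡⟨ nCk+nC[k+1]≡[n+1]C[k+1] m q ⟩
  (suc m C suc q) ∎
  where open ≡-Reasoning

seqsWithRuns : ℕ → ℕ → ℕ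
seqsWithRuns m r = countBy m ‖_‖ r

-- Exactly 2 C(m,q) sequences of length m+1 have q+1 runs (choose the first symbol and the q switch positions).
seqsWithRuns-count : ∀ m q → seqsWithRuns (suc m) (suc q) ≡ 2 * (m C q)
seqsWithRuns-count m q = begin
  seqsWithRuns (suc m) (suc q)
    ≡⟨ countBy-suc m ‖_‖ (suc q) ⟩
  countBy m (λ v → suc (runsFrom false (toList v))) (suc q) + countBy m (λ v → suc (runsFrom true (toList v))) (suc q)
    ≡⟨ cong₂ _+_ (trans (countBy-suc-suc m _ q) (switches-count m false q))
                 (trans (countBy-suc-suc m _ q) (switches-count m true q)) ⟩
  (m C q) + (m C q)         ≡⟨ cong ((m C q) +_) (+-identityʳ (m C q)) ⟨
  2 * (m C q) ∎
  where open ≡-Reasoning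

-- Run-length encodings: lists of (symbol, block length).
Blocks : Set
Blocks = List (Bool × ℕ)

expand : Blocks → List Bool
expand [] = []
expand ((b , ℓ) ∷ bs) = replicate ℓ b ++ expand bs

-- prependBlock b ℓ rest t lists the words  b^(ℓ-k) ++ z  with  z ∈ rest (t-k),  k ≤ t:
-- k of the t deletions hit the leading block b^ℓ, the others hit the remainder.
prependBlock : Bool → ℕ → (ℕ → List (List Bool)) → ℕ → List (List Bool)
prependBlock b ℓ rest zero = map (replicate ℓ b ++_) (rest zero)
prependBlock b ℓ rest (suc t) = map (replicate ℓ b ++_) (rest (suc t)) ++ prependBlock b (ℓ ∸ 1) rest t

-- deletions bs t lists (with repetitions) every word obtained from expand bs by deleting t symbols.
deletions : Blocks → ℕ → List (List Bool)
deletions [] zero = [] ∷ []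
deletions [] (suc t) = []
deletions ((b , ℓ) ∷ bs) = prependBlock b ℓ (deletions bs)

prependBlock-size : ∀ b ℓ rest r → (∀ s → length (rest s) ≤ multichoose r s) →
  ∀ t → length (prependBlock b ℓ rest t) ≤ multichoose (suc r) t
prependBlock-size b ℓ rest r rest-size zero =
  ≤-trans (≤-reflexive (length-map _ (rest zero))) (≤-trans (rest-size zero) (multichoose-mono zero (n≤1+n r)))
prependBlock-size b ℓ rest r rest-size (suc t) = begin
  length (map (replicate ℓ b ++_) (rest (suc t)) ++ prependBlock b (ℓ ∸ 1) rest t)
    ≡⟨ length-++ (map (replicate ℓ b ++_) (rest (suc t))) ⟩
  length (map (replicate ℓ b ++_) (rest (suc t))) + length (prependBlock b (ℓ ∸ 1) rest t)
    ≤⟨ +-mono-≤ (≤-trans (≤-reflexive (length-map _ (rest (suc t)))) (rest-size (suc t)))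
                (prependBlock-size b (ℓ ∸ 1) rest r rest-size t) ⟩
  multichoose r (suc t) + multichoose (suc r) t ∎
  where open ≤-Reasoning

deletions-size : ∀ bs t → length (deletions bs t) ≤ multichoose (length bs) t
deletions-size [] zero = ≤-refl
deletions-size [] (suc t) = z≤n
deletions-size ((b , ℓ) ∷ bs) = prependBlock-size b ℓ (deletions bs) (length bs) (deletions-size bs)

prependBlock-∈ : ∀ b ℓ rest k s {z} → z ∈ rest s → (replicate (ℓ ∸ k) b ++ z) ∈ prependBlock b ℓ rest (k + s)
prependBlock-∈ b ℓ rest zero zero z∈ = ∈-map⁺ (replicate ℓ b ++_) z∈
prependBlock-∈ b ℓ rest zero (suc s) z∈ = ∈-++⁺ˡ (∈-map⁺ (replicate ℓ b ++_) z∈)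
prependBlock-∈ b ℓ rest (suc k) s {z} z∈ =
  ∈-++⁺ʳ (map (replicate ℓ b ++_) (rest (suc (k + s))))
    (subst (λ i → (replicate i b ++ z) ∈ prependBlock b (ℓ ∸ 1) rest (k + s)) (∸-+-assoc ℓ 1 k)
      (prependBlock-∈ b (ℓ ∸ 1) rest k s z∈))

split-block : ∀ (b : Bool) ℓ {R : List Bool} y → y ⊆ (replicate ℓ b ++ R) →
  ∃[ j ] ∃[ z ] (j ≤ ℓ × y ≡ replicate j b ++ z × z ⊆ R)
split-block b zero y y⊆ = 0 , y , z≤n , refl , y⊆
split-block b (suc ℓ) y (.b ∷ʳ y⊆) with split-block b ℓ y y⊆
... | j , z , j≤ℓ , refl , z⊆ = j , z , m≤n⇒m≤1+n j≤ℓ , refl , z⊆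
split-block b (suc ℓ) (.b ∷ y) (refl ∷ y⊆) with split-block b ℓ y y⊆
... | j , z , j≤ℓ , refl , z⊆ = suc j , z , s≤s j≤ℓ , refl , z⊆

-- Counting the deletions: ℓ - j fall in the leading block, r - z in the rest.
deletions-split : ∀ {j ℓ z r t} → j ≤ ℓ → z ≤ r → j + z + t ≡ ℓ + r → (ℓ ∸ j) + (r ∸ z) ≡ t
deletions-split {j} {z = z} {t = t} j≤ℓ z≤r total with m≤n⇒∃[o]m+o≡n j≤ℓ | m≤n⇒∃[o]m+o≡n z≤r
... | k , refl | s , refl = begin
  (j + k ∸ j) + (z + s ∸ z) ≡⟨ cong₂ _+_ (m+n∸m≡n j k) (m+n∸m≡n z s) ⟩
  k + s                     ≡⟨ +-cancelˡ-≡ (j + z) (k + s) t (trans regroup (sym total)) ⟩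
  t ∎
  where
  open ≡-Reasoning
  regroup : j + z + (k + s) ≡ j + k + (z + s)
  regroup = solve 4 (λ j z k s → j :+ z :+ (k :+ s) := j :+ k :+ (z :+ s)) refl j z k s

length-replicate-++ : ∀ j (b : Bool) z → length (replicate j b ++ z) ≡ j + length z
length-replicate-++ j b z = trans (length-++ (replicate j b)) (cong (_+ length z) (length-replicate j))

deletions-complete : ∀ bs t y → y ⊆ expand bs → length y + t ≡ length (expand bs) → y ∈ deletions bs t
deletions-complete [] zero .[] [] _ = here refl
deletions-complete ((b , ℓ) ∷ bs) t y y⊆ |y|+t with split-block b ℓ y y⊆
... | j , z , j≤ℓ , refl , z⊆R =
  subst₂ (λ i s → (replicate i b ++ z) ∈ prependBlock b ℓ (deletions bs) s)
    (m∸[m∸n]≡n j≤ℓ) (deletions-split j≤ℓ |z|≤|R| lengths)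
    (prependBlock-∈ b ℓ (deletions bs) (ℓ ∸ j) _ (deletions-complete bs _ z z⊆R (m+[n∸m]≡n |z|≤|R|)))
  where
  |z|≤|R| : length z ≤ length (expand bs)
  |z|≤|R| = length-mono-≤ z⊆R
  lengths : j + length z + t ≡ ℓ + length (expand bs)
  lengths = trans (cong (_+ t) (sym (length-replicate-++ j b z)))
                  (trans |y|+t (length-replicate-++ ℓ b (expand bs)))

replicate-snoc : ∀ k (b : Bool) ys → replicate k b ++ (b ∷ ys) ≡ replicate (suc k) b ++ ys
replicate-snoc zero b ys = refl
replicate-snoc (suc k) b ys = cong (b ∷_) (replicate-snoc k b ys)

-- rleFrom b k xs: run-length encoding of b^k ++ xs.
rleFrom : Bool → ℕ → List Bool → Blocks
rleFrom b k [] = (b , k) ∷ []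
rleFrom b k (y ∷ ys) with b Bool.≟ y
... | yes _ = rleFrom b (suc k) ys
... | no _ = (b , k) ∷ rleFrom y 1 ys

expand-rleFrom : ∀ b k xs → expand (rleFrom b k xs) ≡ replicate k b ++ xs
expand-rleFrom b k [] = refl
expand-rleFrom b k (y ∷ ys) with b Bool.≟ y
... | yes refl = trans (expand-rleFrom b (suc k) ys) (sym (replicate-snoc k b ys))
... | no _ = cong (replicate k b ++_) (expand-rleFrom y 1 ys)

length-rleFrom : ∀ b k xs → length (rleFrom b k xs) ≡ suc (runsFrom b xs)
length-rleFrom b k [] = refl
length-rleFrom b k (y ∷ ys) with b Bool.≟ y
... | yes refl = length-rleFrom b (suc k) ys
... | no _ = cong suc (length-rleFrom y 1 ys)

rle : List Bool → Blocks
rle [] = []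
rle (x ∷ xs) = rleFrom x 1 xs

expand-rle : ∀ xs → expand (rle xs) ≡ xs
expand-rle [] = refl
expand-rle (x ∷ xs) = expand-rleFrom x 1 xs

length-rle : ∀ xs → length (rle xs) ≡ runs xs
length-rle [] = refl
length-rle (x ∷ xs) = length-rleFrom x 1 xs

deletionBall : ℕ → List Bool → List (List Bool)
deletionBall t x = deletions (rle x) t

-- |dS^t(x)| ≤ C(‖x‖ + t - 1, t): a t-deletion is determined by how many symbols leave each run.
deletionBall-size : ∀ t x → length (deletionBall t x) ≤ multichoose (runs x) t
deletionBall-size t x = subst (λ r → length (deletionBall t x) ≤ multichoose r t) (length-rle x) (deletions-size (rle x) t)

deletionBall-complete : ∀ t x y → dS t x y → y ∈ deletionBall t x
deletionBall-complete t x y (y⊆x , |y|+t) =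
  deletions-complete (rle x) t y (subst (y ⊆_) (sym (expand-rle x)) y⊆x) (trans |y|+t (cong length (sym (expand-rle x))))

sumFrom : (ℕ → ℕ) → ℕ → ℕ → ℕ
sumFrom f lo zero = 0
sumFrom f lo (suc k) = f lo + sumFrom f (suc lo) k

sum-applyUpTo : ∀ k lo (f F : ℕ → ℕ) → (∀ i → F i ≡ f (lo + i)) → sum (applyUpTo F k) ≡ sumFrom f lo k
sum-applyUpTo zero lo f F F≗ = refl
sum-applyUpTo (suc k) lo f F F≗ = cong₂ _+_ (trans (F≗ 0) (cong f (+-identityʳ lo)))
  (sum-applyUpTo k (suc lo) f (λ i → F (suc i)) (λ i → trans (F≗ (suc i)) (cong f (+-suc lo i))))

sumRange≡sumFrom : ∀ lo hi f → sumRange lo hi f ≡ sumFrom f lo (suc hi ∸ lo)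
sumRange≡sumFrom lo hi f = trans (cong sum (map-applyUpTo (λ i → i) (λ i → f (lo + i)) (suc hi ∸ lo)))
  (sum-applyUpTo (suc hi ∸ lo) lo f (λ i → f (lo + i)) (λ i → refl))

sumFrom-mono : ∀ f g lo k → (∀ p → lo ≤ p → p < lo + k → f p ≤ g p) → sumFrom f lo k ≤ sumFrom g lo k
sumFrom-mono f g lo zero f≤g = z≤n
sumFrom-mono f g lo (suc k) f≤g = +-mono-≤ (f≤g lo ≤-refl (m<m+n lo z<s))
  (sumFrom-mono f g (suc lo) k λ p lo<p p<lo+k →
    f≤g p (<⇒≤ lo<p) (≤-trans p<lo+k (≤-reflexive (sym (+-suc lo k)))))

sumFrom-*ˡ : ∀ c f lo k → sumFrom (λ p → c * f p) lo k ≡ c * sumFrom f lo k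
sumFrom-*ˡ c f lo zero = sym (*-zeroʳ c)
sumFrom-*ˡ c f lo (suc k) = trans (cong (c * f lo +_) (sumFrom-*ˡ c f (suc lo) k)) (sym (*-distribˡ-+ c (f lo) _))

sumFrom-*ʳ : ∀ c f lo k → sumFrom (λ p → f p * c) lo k ≡ sumFrom f lo k * c
sumFrom-*ʳ c f lo zero = refl
sumFrom-*ʳ c f lo (suc k) = trans (cong (f lo * c +_) (sumFrom-*ʳ c f (suc lo) k)) (sym (*-distribʳ-+ c (f lo) _))

concatFrom : ∀ {A : Set} → (ℕ → List A) → ℕ → ℕ → List A
concatFrom blk lo zero = []
concatFrom blk lo (suc k) = blk lo ++ concatFrom blk (suc lo) k

length-concatFrom : ∀ {A : Set} (blk : ℕ → List A) lo k →
  length (concatFrom blk lo k) ≡ sumFrom (λ r → length (blk r)) lo k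
length-concatFrom blk lo zero = refl
length-concatFrom blk lo (suc k) = trans (length-++ (blk lo)) (cong (length (blk lo) +_) (length-concatFrom blk (suc lo) k))

∈-concatFrom⁺ : ∀ {A : Set} (blk : ℕ → List A) lo k r {x} →
  lo ≤ r → r < lo + k → x ∈ blk r → x ∈ concatFrom blk lo k
∈-concatFrom⁺ blk lo zero r lo≤r r<lo+0 x∈ =
  ⊥-elim (<-irrefl refl (≤-trans r<lo+0 (≤-trans (≤-reflexive (+-identityʳ lo)) lo≤r)))
∈-concatFrom⁺ blk lo (suc k) r lo≤r r<lo+k x∈ with lo ≟ r
... | yes refl = ∈-++⁺ˡ x∈
... | no lo≢r = ∈-++⁺ʳ (blk lo)
  (∈-concatFrom⁺ blk (suc lo) k r (≤∧≢⇒< lo≤r lo≢r) (≤-trans r<lo+k (≤-reflexive (+-suc lo k))) x∈)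

∈-concatFrom⁻ : ∀ {A : Set} (blk : ℕ → List A) lo k {x} →
  x ∈ concatFrom blk lo k → ∃[ r ] (lo ≤ r × r < lo + k × x ∈ blk r)
∈-concatFrom⁻ blk lo (suc k) x∈ with ∈-++⁻ (blk lo) x∈
... | inj₁ x∈blk = lo , ≤-refl , m<m+n lo z<s , x∈blk
... | inj₂ x∈rest with ∈-concatFrom⁻ blk (suc lo) k x∈rest
...   | r , lo<r , r<lo+k , x∈blk = r , <⇒≤ lo<r , ≤-trans r<lo+k (≤-reflexive (sym (+-suc lo k))) , x∈blk

concatFrom-unique : ∀ {A : Set} (blk : ℕ → List A) → (∀ r → Unique (blk r)) →
  (∀ r s {x} → x ∈ blk r → x ∈ blk s → r ≡ s) → ∀ lo k → Unique (concatFrom blk lo k)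
concatFrom-unique blk unique disjoint lo zero = []
concatFrom-unique blk unique disjoint lo (suc k) =
  Unique.++⁺ (unique lo) (concatFrom-unique blk unique disjoint (suc lo) k) lo-fresh
  where
  lo-fresh : ∀ {x} → ¬ (x ∈ blk lo × x ∈ concatFrom blk (suc lo) k)
  lo-fresh (x∈lo , x∈rest) with ∈-concatFrom⁻ blk (suc lo) k x∈rest
  ... | r , lo<r , _ , x∈r with disjoint lo r x∈lo x∈r
  ...   | refl = <-irrefl refl lo<r

unique-length : ∀ {A : Set} {zs ws : List A} → Unique zs → (∀ {z} → z ∈ zs → z ∈ ws) → length zs ≤ length ws
unique-length {zs = []} _ _ = z≤n
unique-length {zs = z ∷ zs} {ws} (z∉zs ∷ unique) zs⊆ws with ∈-∃++ (zs⊆ws (here refl))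
... | ws₁ , ws₂ , refl = begin
  suc (length zs)                ≤⟨ s≤s (unique-length unique zs⊆ws₁++ws₂) ⟩
  suc (length (ws₁ ++ ws₂))      ≡⟨ cong suc (length-++ ws₁) ⟩
  suc (length ws₁ + length ws₂)  ≡⟨ +-suc (length ws₁) (length ws₂) ⟨
  length ws₁ + length (z ∷ ws₂)  ≡⟨ length-++ ws₁ ⟨
  length (ws₁ ++ z ∷ ws₂) ∎
  where
  open ≤-Reasoning
  zs⊆ws₁++ws₂ : ∀ {v} → v ∈ zs → v ∈ ws₁ ++ ws₂
  zs⊆ws₁++ws₂ {v} v∈zs with ∈-++⁻ ws₁ (zs⊆ws (there v∈zs))
  ... | inj₁ v∈ws₁ = ∈-++⁺ˡ v∈ws₁
  ... | inj₂ (here refl) = ⊥-elim (lookup z∉zs v∈zs refl)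
  ... | inj₂ (there v∈ws₂) = ∈-++⁺ʳ ws₁ v∈ws₂

length-concatMap : ∀ {X Z : Set} (B : X → List Z) (M : ℕ) xs →
  (∀ {x} → x ∈ xs → length (B x) ≤ M) → length (concatMap B xs) ≤ length xs * M
length-concatMap B M [] _ = z≤n
length-concatMap B M (x ∷ xs) bound = ≤-trans (≤-reflexive (length-++ (B x)))
  (+-mono-≤ (bound (here refl)) (length-concatMap B M xs (λ x∈ → bound (there x∈))))

injection-count : ∀ {X Y Z : Set} (h : Y → Z) → (∀ {y y'} → h y ≡ h y' → y ≡ y') →
  (B : X → List Z) (M : ℕ) (xs : List X) {ys : List Y} → Unique ys →
  (∀ {y} → y ∈ ys → Any (λ x → h y ∈ B x) xs) → (∀ {x} → x ∈ xs → length (B x) ≤ M) →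
  length ys ≤ length xs * M
injection-count h h-injective B M xs {ys} unique covered bound = begin
  length ys                ≡⟨ length-map h ys ⟨
  length (map h ys)        ≤⟨ unique-length (Unique.map⁺ h-injective unique) image⊆ ⟩
  length (concatMap B xs)  ≤⟨ length-concatMap B M xs bound ⟩
  length xs * M ∎
  where
  open ≤-Reasoning
  image⊆ : ∀ {z} → z ∈ map h ys → z ∈ concatMap B xs
  image⊆ z∈ with ∈-map⁻ h z∈
  ... | y , y∈ys , refl = ∈-concatMap⁺ B (covered y∈ys)

Covers : (t n : ℕ) → Code n → Set
Covers t n Cd = ∀ (y : Vec Bool (n ∸ t)) → ∃[ c ] (Cd c ≡ true × dS t (toList c) (toList y))

wordsWithRuns : ∀ m → ℕ → List (Vec Bool m)
wordsWithRuns m p = filter (λ v → ‖ v ‖ ≟ p) (allSeqs m)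

codewordsWithRuns : ∀ {n} → Code n → ℕ → List (Vec Bool n)
codewordsWithRuns {n} Cd r = filter (λ x → (Cd x ∧ ⌊ ‖ x ‖ ≟ r ⌋) Bool.≟ true) (allSeqs n)

∈-wordsWithRuns⁻ : ∀ {m p y} → y ∈ wordsWithRuns m p → ‖ y ‖ ≡ p
∈-wordsWithRuns⁻ {m} {p} y∈ = proj₂ (∈-filter⁻ (λ v → ‖ v ‖ ≟ p) {xs = allSeqs m} y∈)

∈-codewordsWithRuns⁺ : ∀ {n} (Cd : Code n) {x} → Cd x ≡ true → x ∈ codewordsWithRuns Cd ‖ x ‖
∈-codewordsWithRuns⁺ Cd {x} x∈C =
  ∈-filter⁺ _ (allSeqs-complete x) (cong₂ _∧_ x∈C (cong ⌊_⌋ (≟-diag {‖ x ‖} refl)))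

∈-codewordsWithRuns⁻ : ∀ {n} (Cd : Code n) {r x} → x ∈ codewordsWithRuns Cd r → ‖ x ‖ ≡ r
∈-codewordsWithRuns⁻ {n} Cd {r} {x} x∈ = toWitness (subst T (sym (∧-conicalʳ (Cd x) _ selected)) tt)
  where
  selected : (Cd x ∧ ⌊ ‖ x ‖ ≟ r ⌋) ≡ true
  selected = proj₂ (∈-filter⁻ (λ x → (Cd x ∧ ⌊ ‖ x ‖ ≟ r ⌋) Bool.≟ true) {xs = allSeqs n} x∈)

-- The index window [a, a + (1 + m - a)) of sumRange a m is {r : a ≤ r ≤ m}.
window-end : ∀ {a m r} → a ≤ suc m → r < a + (suc m ∸ a) → r ≤ m
window-end a≤1+m r<end = ≤-pred (≤-trans r<end (≤-reflexive (m+[n∸m]≡n a≤1+m)))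

window-inside : ∀ {a m r} → a ≤ suc m → r ≤ m → r < a + (suc m ∸ a)
window-inside a≤1+m r≤m = ≤-trans (s≤s r≤m) (≤-reflexive (sym (m+[n∸m]≡n a≤1+m)))

toList-injective′ : ∀ {A : Set} {m} {y y' : Vec A m} → toList y ≡ toList y' → y ≡ y'
toList-injective′ {y = y} {y'} eq = trans (sym (cast-is-id refl y)) (toList-injective refl y y' eq)

-- A word of length n - t with a ≤ ‖y‖ ≤ b lies in the t-deletion ball of a codeword x with
-- a ≤ ‖x‖ ≤ b + 2t (deletion-runs), and each such ball has at most multichoose (b + 2t) t
-- elements; counting the words y through their codewords (injection-count) gives
--   Σ_{a≤p≤b} #{y : ‖y‖ = p} ≤ (Σ_{a≤r≤b+2t} #C_r) · multichoose (b + 2t) t.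
covering-count : ∀ t n (Cd : Code n) → Covers t n Cd → ∀ a b → a ≤ b →
  sumFrom (seqsWithRuns (n ∸ t)) a (suc b ∸ a)
    ≤ sumFrom (countRuns Cd) a (suc (b + 2 * t) ∸ a) * multichoose (b + 2 * t) t
covering-count t n Cd cover a b a≤b = begin
  sumFrom (seqsWithRuns (n ∸ t)) a kY             ≡⟨ length-concatFrom (wordsWithRuns (n ∸ t)) a kY ⟨
  length ys                                      ≤⟨ injection-count toList toList-injective′ ball (multichoose hi t)
                                                      xs ys-unique in-ball-of-xs ball-bound ⟩
  length xs * multichoose hi t                   ≡⟨ cong (_* multichoose hi t) (length-concatFrom (codewordsWithRuns Cd) a kX) ⟩
  sumFrom (countRuns Cd) a kX * multichoose hi t ∎
  where
  open ≤-Reasoning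
  hi kY kX : ℕ
  hi = b + 2 * t
  kY = suc b ∸ a
  kX = suc hi ∸ a
  a≤1+b : a ≤ suc b
  a≤1+b = m≤n⇒m≤1+n a≤b
  a≤1+hi : a ≤ suc hi
  a≤1+hi = m≤n⇒m≤1+n (≤-trans a≤b (m≤m+n b (2 * t)))
  ys : List (Vec Bool (n ∸ t))
  ys = concatFrom (wordsWithRuns (n ∸ t)) a kY
  xs : List (Vec Bool n)
  xs = concatFrom (codewordsWithRuns Cd) a kX
  ball : Vec Bool n → List (List Bool)
  ball x = deletionBall t (toList x)

  ys-unique : Unique ys
  ys-unique = concatFrom-unique (wordsWithRuns (n ∸ t)) (λ p → Unique.filter⁺ _ (allSeqs-unique (n ∸ t)))
    (λ p q y∈p y∈q → trans (sym (∈-wordsWithRuns⁻ y∈p)) (∈-wordsWithRuns⁻ y∈q)) a kY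

  in-ball-of-xs : ∀ {y} → y ∈ ys → Any (λ x → toList y ∈ ball x) xs
  in-ball-of-xs {y} y∈ys with ∈-concatFrom⁻ (wordsWithRuns (n ∸ t)) a kY y∈ys | cover y
  ... | p , a≤p , p<end , y∈p | x , x∈C , y∈dSx = Any.map (λ { refl → deletionBall-complete t _ _ y∈dSx }) x∈xs
    where
    ‖y‖≡p : ‖ y ‖ ≡ p
    ‖y‖≡p = ∈-wordsWithRuns⁻ y∈p
    ‖y‖≤‖x‖ : ‖ y ‖ ≤ ‖ x ‖
    ‖y‖≤‖x‖ = proj₁ (deletion-runs t (toList x) (toList y) y∈dSx)
    ‖x‖≤‖y‖+2t : ‖ x ‖ ≤ ‖ y ‖ + 2 * t
    ‖x‖≤‖y‖+2t = proj₂ (deletion-runs t (toList x) (toList y) y∈dSx)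
    ‖x‖≤hi : ‖ x ‖ ≤ hi
    ‖x‖≤hi = ≤-trans ‖x‖≤‖y‖+2t (+-monoˡ-≤ (2 * t) (subst (_≤ b) (sym ‖y‖≡p) (window-end a≤1+b p<end)))
    x∈xs : x ∈ xs
    x∈xs = ∈-concatFrom⁺ (codewordsWithRuns Cd) a kX ‖ x ‖ (≤-trans a≤p (subst (_≤ ‖ x ‖) ‖y‖≡p ‖y‖≤‖x‖))
             (window-inside a≤1+hi ‖x‖≤hi) (∈-codewordsWithRuns⁺ Cd x∈C)

  ball-bound : ∀ {x} → x ∈ xs → length (ball x) ≤ multichoose hi t
  ball-bound {x} x∈xs with ∈-concatFrom⁻ (codewordsWithRuns Cd) a kX x∈xs
  ... | r , _ , r<end , x∈r = ≤-trans (deletionBall-size t (toList x))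
        (multichoose-mono t (subst (_≤ hi) (sym (∈-codewordsWithRuns⁻ Cd x∈r)) (window-end a≤1+hi r<end)))

-- 2 C(m, p+t) C(p+t, t) ≤ #{y ∈ 𝔹^(m+1-t) : ‖y‖ = p+1} · C(m, t), with equality when t ≤ m:
-- both sides count a t-subset of [m] together with a p-subset of its complement (and a first symbol).
subsets-to-runs : ∀ t m p → 2 * ((m C (p + t)) * ((p + t) C t)) ≤ seqsWithRuns (suc m ∸ t) (suc p) * (m C t)
subsets-to-runs t m p with t ≤? m
... | yes t≤m = ≤-reflexive (begin
  2 * ((m C (p + t)) * ((p + t) C t))        ≡⟨ cong (2 *_) (C-subset-of-subset m p t) ⟩
  2 * ((m C t) * ((m ∸ t) C p))              ≡⟨ cong (2 *_) (*-comm (m C t) ((m ∸ t) C p)) ⟩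
  2 * (((m ∸ t) C p) * (m C t))              ≡⟨ *-assoc 2 ((m ∸ t) C p) (m C t) ⟨
  2 * ((m ∸ t) C p) * (m C t)                ≡⟨ cong (_* (m C t)) (seqsWithRuns-count (m ∸ t) p) ⟨
  seqsWithRuns (suc (m ∸ t)) (suc p) * (m C t) ≡⟨ cong (λ k → seqsWithRuns k (suc p) * (m C t)) (+-∸-assoc 1 t≤m) ⟨
  seqsWithRuns (suc m ∸ t) (suc p) * (m C t) ∎)
  where open ≡-Reasoning
... | no t≰m = ≤-trans (≤-reflexive (cong (λ x → 2 * (x * ((p + t) C t))) (k>n⇒nCk≡0 m<p+t))) z≤n
  where
  m<p+t : m < p + t
  m<p+t = ≤-trans (≰⇒> t≰m) (m≤n+m t p)

-- The bound for a single number of runs p'+1 ≥ c'+d+1, with the log-concavity step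
-- C(c'+t,t) C(c'+d+e+t,t) ≤ C(c'+d+t,t) C(c'+e+t,t) ≤ C(p'+t,t) C(c'+e+t,t).
length-bound : ∀ t m c' d e p' → c' + d ≤ p' →
  2 * ((c' + t) C t) * (m C (p' + t)) * ((c' + d + e + t) C t)
    ≤ seqsWithRuns (suc m ∸ t) (suc p') * (((c' + e + t) C t) * (m C t))
length-bound t m c' d e p' c'+d≤p' = begin
  2 * A * X * F         ≡⟨ solve 4 (λ a x f two → two :* a :* x :* f := two :* x :* (a :* f)) refl A X F 2 ⟩
  2 * X * (A * F)       ≤⟨ *-monoʳ-≤ (2 * X) (C-log-concave c' d e t) ⟩
  2 * X * (((c' + d + t) C t) * D)
                        ≤⟨ *-monoʳ-≤ (2 * X) (*-monoˡ-≤ D (C-mono-upper t (+-monoˡ-≤ t c'+d≤p'))) ⟩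
  2 * X * (Q * D)       ≡⟨ solve 4 (λ x q d two → two :* x :* (q :* d) := two :* (x :* q) :* d) refl X Q D 2 ⟩
  2 * (X * Q) * D       ≤⟨ *-monoˡ-≤ D (subsets-to-runs t m p') ⟩
  R * E * D             ≡⟨ solve 3 (λ r e d → r :* e :* d := r :* (d :* e)) refl R E D ⟩
  R * (D * E) ∎
  where
  open ≤-Reasoning
  A X F D Q E R : ℕ
  A = (c' + t) C t
  X = m C (p' + t)
  F = (c' + d + e + t) C t
  D = (c' + e + t) C t
  Q = (p' + t) C t
  E = m C t
  R = seqsWithRuns (suc m ∸ t) (suc p')

-- The index of the binomial C(c + b - a + 3t - 1, t) of the theorem, for b = a + w and c = c' + 1.
window-index : ∀ c' a w t → suc c' + (a + w) ∸ a + 3 * t ∸ 1 ≡ c' + (w + 2 * t) + t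
window-index c' a w t = begin
  suc c' + (a + w) ∸ a + 3 * t ∸ 1  ≡⟨ cong (λ k → k ∸ a + 3 * t ∸ 1) (+-assoc (suc c') a w) ⟨
  suc c' + a + w ∸ a + 3 * t ∸ 1    ≡⟨ cong (λ k → k + w ∸ a + 3 * t ∸ 1) (+-comm (suc c') a) ⟩
  a + suc c' + w ∸ a + 3 * t ∸ 1    ≡⟨ cong (λ k → k ∸ a + 3 * t ∸ 1) (+-assoc a (suc c') w) ⟩
  a + (suc c' + w) ∸ a + 3 * t ∸ 1  ≡⟨ cong (λ k → k + 3 * t ∸ 1) (m+n∸m≡n a (suc c' + w)) ⟩
  c' + w + 3 * t
    ≡⟨ solve 3 (λ c w t → c :+ w :+ con 3 :* t := c :+ (w :+ con 2 :* t) :+ t) refl c' w t ⟩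
  c' + (w + 2 * t) + t ∎
  where open ≡-Reasoning

length-bound-at : ∀ t n c a b p → 1 ≤ n → 1 ≤ c → c ≤ a → a ≤ b → a ≤ p →
  2 * ((c + t ∸ 1) C t) * ((n ∸ 1) C (p + t ∸ 1)) * multichoose (b + 2 * t) t
    ≤ seqsWithRuns (n ∸ t) p * (((c + b ∸ a + 3 * t ∸ 1) C t) * ((n ∸ 1) C t))
length-bound-at t (suc m) (suc c') a b zero _ _ c≤a _ a≤0 with () ← ≤-trans c≤a a≤0
length-bound-at t (suc m) (suc c') a b (suc p') _ _ c≤a a≤b a≤p
  with d , refl ← m≤n⇒∃[o]m+o≡n c≤a
  with w , refl ← m≤n⇒∃[o]m+o≡n a≤b
  rewrite multichoose-C (c' + d + w + 2 * t) t | +-assoc (c' + d) w (2 * t) | window-index c' (suc c' + d) w t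
  = length-bound t m c' d (w + 2 * t) p' (≤-pred a≤p)

-- The theorem: sum the per-length bounds over a ≤ p ≤ b, apply covering-count, and cancel
-- the positive factor C(b+3t-1, t).
lemma11 : (t n : ℕ) → 1 ≤ t → (Cd : Code n) → IsPerfectDeletionCode t n Cd →
          (a b c : ℕ) → 1 ≤ c → c ≤ a → a < b → b ≤ n →
          2 * ((c + t ∸ 1) C t) * sumRange a b (λ p → (n ∸ 1) C (p + t ∸ 1))
            ≤ sumRange a (b + 2 * t) (countRuns Cd) * ((c + b ∸ a + 3 * t ∸ 1) C t) * ((n ∸ 1) C t)
lemma11 t n _ Cd (_ , _ , cover) a b c 1≤c c≤a a<b b≤n = *-cancelʳ-≤ _ _ F {{F≢0}} (begin
  2 * A * sumRange a b X * F                          ≡⟨ cong (λ s → 2 * A * s * F) (sumRange≡sumFrom a b X) ⟩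
  2 * A * sumFrom X a kY * F                          ≡⟨ constants-out ⟨
  sumFrom (λ p → 2 * A * X p * F) a kY                ≤⟨ sumFrom-mono _ _ a kY per-length ⟩
  sumFrom (λ p → seqsWithRuns (n ∸ t) p * (D * E)) a kY ≡⟨ sumFrom-*ʳ (D * E) (seqsWithRuns (n ∸ t)) a kY ⟩
  sumFrom (seqsWithRuns (n ∸ t)) a kY * (D * E)       ≤⟨ *-monoˡ-≤ (D * E) (covering-count t n Cd cover a b a≤b) ⟩
  sumFrom (countRuns Cd) a kX * F * (D * E)           ≡⟨ cong (λ s → s * F * (D * E)) (sumRange≡sumFrom a hi (countRuns Cd)) ⟨
  K * F * (D * E)                                     ≡⟨ move-last K F D E ⟩
  K * D * E * F ∎)
  where
  open ≤-Reasoning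
  hi kY kX A D E F K : ℕ
  hi = b + 2 * t
  kY = suc b ∸ a
  kX = suc hi ∸ a
  A = (c + t ∸ 1) C t
  D = (c + b ∸ a + 3 * t ∸ 1) C t
  E = (n ∸ 1) C t
  F = multichoose hi t
  K = sumRange a hi (countRuns Cd)
  X : ℕ → ℕ
  X p = (n ∸ 1) C (p + t ∸ 1)
  a≤b : a ≤ b
  a≤b = <⇒≤ a<b
  1≤b : 1 ≤ b
  1≤b = ≤-trans (s≤s z≤n) a<b
  move-last : ∀ k f d e → k * f * (d * e) ≡ k * d * e * f
  move-last = solve 4 (λ k f d e → k :* f :* (d :* e) := k :* d :* e :* f) refl
  F≢0 : NonZero F
  F≢0 = >-nonZero (multichoose-pos t (≤-trans 1≤b (m≤m+n b (2 * t))))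
  constants-out : sumFrom (λ p → 2 * A * X p * F) a kY ≡ 2 * A * sumFrom X a kY * F
  constants-out = trans (sumFrom-*ʳ F (λ p → 2 * A * X p) a kY) (cong (_* F) (sumFrom-*ˡ (2 * A) X a kY))
  per-length : ∀ p → a ≤ p → p < a + kY → 2 * A * X p * F ≤ seqsWithRuns (n ∸ t) p * (D * E)
  per-length p a≤p _ = length-bound-at t n c a b p (≤-trans 1≤b b≤n) 1≤c c≤a a≤b a≤p
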